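{- Under the hypotheses below, $\mathit{hy}$ absorbs $\mathit{ev}$, i.e. $\mathit{hy}\circ\mathit{ev}=\mathit{hy}$ as partial functions on $\lambda$-terms. Hypotheses: $\mathit{ev}$, $\mathit{rb}$, $\mathit{su}$, $\mathit{hy}$ are evaluators defined as in the context with parameters satisfying the stated provisos, and the equations $\mathit{la}_e=\mathit{la}_s$, $\mathit{ar}_{1e}=\mathit{ar}_{1s}$, $\mathit{ar}_{2e}=\mathit{ar}_{2s}$, $\mathit{la}_r\circ\mathit{la}_e=\mathit{la}_h$, $\mathit{ar}_{2r}\circ\mathit{ar}_{2e}=\mathit{ar}_{2h}$ hold, where both sides are compared after identifying $\mathit{ev}$ with $\mathit{su}$ and $\mathit{rb}\circ\mathit{ev}$ with $\mathit{hy}$ and simplifying compositions with $\mathrm{id}$.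
   Context: Terms: $\Lambda ::= x\mid \lambda x.\Lambda\mid \Lambda\Lambda$ (modulo $\alpha$); $[N/x]B$ is capture-avoiding substitution. An evaluator is a partial function $\Lambda\rightharpoonup\Lambda$ (undefined = divergence); $\mathrm{id}$ is the identity; $(E_2\circ E_1)(M)=E_2(E_1(M))$, undefined if $E_1(M)$ is. $E_2$ absorbs $E_1$ iff $E_2\circ E_1=E_2$. Eval-apply template $\mathrm{EA}(\mathit{la},\mathit{op}_1,\mathit{ar}_1,\mathit{op}_2,\mathit{ar}_2)$: the least $E$ with $E(x)=x$; $E(\lambda x.B)=\lambda x.\mathit{la}(B)$; for $E(MN)$: compute $M'=\mathit{op}_1(M)$; if $M'\equiv\lambda x.B$, compute $N'=\mathit{ar}_1(N)$ and return $E([N'/x]B)$; otherwise compute $M''=\mathit{op}_2(M')$, then $N'=\mathit{ar}_2(N)$, and return $M''N'$ (in this order; divergence propagates). Readback template $\mathrm{RB}(\mathit{la},\mathit{ar}_2)$: the least $R$ with $R(x)=x$, $R(\lambda x.B)=\lambda x.\mathit{la}(B)$, $R(MN)=R(M)\,\mathit{ar}_2(N)$. Definitions and provisos: (1) $\mathit{ev}=\mathrm{EA}(\mathit{la}_e,\mathit{ev},\mathit{ar}_{1e},\mathrm{id},\mathit{ar}_{2e})$ with $\mathit{la}_e,\mathit{ar}_{1e},\mathit{ar}_{2e}\in\{\mathrm{id},\mathit{ev}\}$. (2) $\mathit{rb}=\mathrm{RB}(\mathit{la}_r,\mathit{ar}_{2r})$ where, for each pair $(\mathit{la}_r,\mathit{la}_e)$,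 $(\mathit{ar}_{2r},\mathit{ar}_{2e})$: if the eval parameter is $\mathrm{id}$ the readback parameter is one of $\mathrm{id},\mathit{ev},\mathit{rb}\circ\mathit{ev}$; if it is $\mathit{ev}$ the readback parameter is $\mathrm{id}$ or $\mathit{rb}$; at least one of $\mathit{la}_r,\mathit{ar}_{2r}$ is $\mathit{ev}$ or $\mathit{rb}\circ\mathit{ev}$ at a position whose eval parameter is $\mathrm{id}$, and at least one is $\mathit{rb}$ or $\mathit{rb}\circ\mathit{ev}$. (3) $\mathit{su}=\mathrm{EA}(\mathit{la}_s,\mathit{su},\mathit{ar}_{1s},\mathrm{id},\mathit{ar}_{2s})$ with $\mathit{la}_s,\mathit{ar}_{1s},\mathit{ar}_{2s}\in\{\mathrm{id},\mathit{su}\}$. (4) $\mathit{hy}=\mathrm{EA}(\mathit{la}_h,\mathit{su},\mathit{ar}_{1s},\mathit{hy},\mathit{ar}_{2h})$ where, for each pair $(\mathit{la}_h,\mathit{la}_s)$, $(\mathit{ar}_{2h},\mathit{ar}_{2s})$: if the subsidiary parameter is $\mathrm{id}$ the hybrid parameter is one of $\mathrm{id},\mathit{su},\mathit{hy}$; if it is $\mathit{su}$ the hybrid parameter is $\mathit{su}$ or $\mathit{hy}$; at least one of $\mathit{la}_h,\mathit{ar}_{2h}$ is $\mathit{hy}$, and at least one is $\mathit{su}$ or $\mathit{hy}$ at a position whose subsidiary parameter is $\mathrm{id}$. -}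

module Defs where

open import Data.Nat using (ℕ; zero; suc)
open import Data.Product using (Σ; _×_; _,_)
open import Data.Sum using (_⊎_)
open import Relation.Binary.PropositionalEquality using (_≡_)
open import Relation.Nullary using (¬_)
open import Function.Bundles using (_⇔_)

-- λ-terms modulo α: de Bruijn indices (unscoped, open terms allowed)

data Term : Set where
  var : ℕ → Term
  lam : Term → Term
  app : Term → Term → Term

rename : (ℕ → ℕ) → Term → Term
rename ρ (var x)   = var (ρ x)
rename ρ (lam B)   = lam (rename (λ { zero → zero ; (suc x) → suc (ρ x) }) B)
rename ρ (app M N) = app (rename ρ M) (rename ρ N)

exts : (ℕ → Term) → ℕ → Term
exts σ zero    = var zero
exts σ (suc x) = rename suc (σ x)

subst : (ℕ → Term) → Term → Term
subst σ (var x)   = σ x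
subst σ (lam B)   = lam (subst (exts σ) B)
subst σ (app M N) = app (subst σ M) (subst σ N)

-- [N/x]B where B is the body of λx.B (x = index 0)
_[_] : Term → Term → Term
B [ N ] = subst (λ { zero → N ; (suc x) → var x }) B

data IsLam : Term → Set where
  isLam : ∀ B → IsLam (lam B)

-- Partial functions are represented by their graphs (big-step relations);
-- each relation below is the least one closed under the template rules,
-- i.e. the graph of the least fixed point.

Rel : Set₁
Rel = Term → Term → Set

-- Parameter of a self-referential eval-apply evaluator (ev or su): id or itself.
data SelfP : Set where
  idP selfP : SelfP

-- E = EA(la, E, ar1, id, ar2) with la, ar1, ar2 ∈ {id, E}
module SelfEval (la ar1 ar2 : SelfP) where
  mutual
    data Par : SelfP → Term → Term → Set where
      pid  : ∀ {M} → Par idP M M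
      pself : ∀ {M N} → Eval M N → Par selfP M N

    data Eval : Term → Term → Set where
      e-var  : ∀ {x} → Eval (var x) (var x)
      e-lam  : ∀ {B B'} → Par la B B' → Eval (lam B) (lam B')
      e-beta : ∀ {M N B N' V} → Eval M (lam B) → Par ar1 N N' →
               Eval (B [ N' ]) V → Eval (app M N) V
      e-neu  : ∀ {M N M' N'} → Eval M M' → ¬ IsLam M' → Par ar2 N N' →
               Eval (app M N) (app M' N')

Ev : (la ar1 ar2 : SelfP) → Rel
Ev = SelfEval.Eval

Su : (la ar1 ar2 : SelfP) → Rel
Su = SelfEval.Eval

-- Readback rb = RB(la_r, ar2_r), parameters in {id, ev, rb, rb∘ev}

data RbP : Set where
  idR evR rbR rbevR : RbP

module Readback (le a1e a2e : SelfP) (lr a2r : RbP) where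
  mutual
    data ParR : RbP → Term → Term → Set where
      rid   : ∀ {M} → ParR idR M M
      rev   : ∀ {M N} → Ev le a1e a2e M N → ParR evR M N
      rrb   : ∀ {M N} → Rb M N → ParR rbR M N
      rrbev : ∀ {M K N} → Ev le a1e a2e M K → Rb K N → ParR rbevR M N

    data Rb : Term → Term → Set where
      r-var : ∀ {x} → Rb (var x) (var x)
      r-lam : ∀ {B B'} → ParR lr B B' → Rb (lam B) (lam B')
      r-app : ∀ {M N M' N'} → Rb M M' → ParR a2r N N' → Rb (app M N) (app M' N')

-- Hybrid hy = EA(la_h, su, ar1_s, hy, ar2_h), parameters in {id, su, hy}

data HyP : Set where
  idH suH hyH : HyP

module Hybrid (ls a1s a2s : SelfP) (lh a2h : HyP) where
  open SelfEval ls a1s a2s using () renaming (Par to ParS)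

  mutual
    data ParH : HyP → Term → Term → Set where
      hid : ∀ {M} → ParH idH M M
      hsu : ∀ {M N} → Su ls a1s a2s M N → ParH suH M N
      hhy : ∀ {M N} → Hy M N → ParH hyH M N

    data Hy : Term → Term → Set where
      h-var  : ∀ {x} → Hy (var x) (var x)
      h-lam  : ∀ {B B'} → ParH lh B B' → Hy (lam B) (lam B')
      h-beta : ∀ {M N B N' V} → Su ls a1s a2s M (lam B) → ParS a1s N N' →
               Hy (B [ N' ]) V → Hy (app M N) V
      h-neu  : ∀ {M N M' M'' N'} → Su ls a1s a2s M M' → ¬ IsLam M' →
               Hy M' M'' → ParH a2h N N' → Hy (app M N) (app M'' N')

HyE : (ls a1s a2s : SelfP) (lh a2h : HyP) → Rel
HyE = Hybrid.Hy

data RbPairOK : RbP → SelfP → Set where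
  ok-id-id   : RbPairOK idR   idP
  ok-ev-id   : RbPairOK evR   idP
  ok-rbev-id : RbPairOK rbevR idP
  ok-id-ev   : RbPairOK idR   selfP
  ok-rb-ev   : RbPairOK rbR   selfP

EvAtId : RbP → SelfP → Set
EvAtId r e = (r ≡ evR ⊎ r ≡ rbevR) × e ≡ idP

IsRbish : RbP → Set
IsRbish r = r ≡ rbR ⊎ r ≡ rbevR

RbProviso : (le a2e : SelfP) (lr a2r : RbP) → Set
RbProviso le a2e lr a2r =
  RbPairOK lr le × RbPairOK a2r a2e ×
  (EvAtId lr le ⊎ EvAtId a2r a2e) × (IsRbish lr ⊎ IsRbish a2r)

data HyPairOK : HyP → SelfP → Set where
  ok-id-id : HyPairOK idH idP
  ok-su-id : HyPairOK suH idP
  ok-hy-id : HyPairOK hyH idP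
  ok-su-su : HyPairOK suH selfP
  ok-hy-su : HyPairOK hyH selfP

SuHyAtId : HyP → SelfP → Set
SuHyAtId h s = (h ≡ suH ⊎ h ≡ hyH) × s ≡ idP

HyProviso : (ls a2s : SelfP) (lh a2h : HyP) → Set
HyProviso ls a2s lh a2h =
  HyPairOK lh ls × HyPairOK a2h a2s ×
  (lh ≡ hyH ⊎ a2h ≡ hyH) × (SuHyAtId lh ls ⊎ SuHyAtId a2h a2s)

-- r ∘ e = h, after identifying ev with su and rb∘ev with hy and
-- simplifying compositions with id.  Only the combinations where both
-- sides become syntactically equal are listed.
data CompEq : RbP → SelfP → HyP → Set where
  c-id-id   : CompEq idR   idP   idH
  c-ev-id   : CompEq evR   idP   suH
  c-rbev-id : CompEq rbevR idP   hyH
  c-id-ev   : CompEq idR   selfP suH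
  c-rb-ev   : CompEq rbR   selfP hyH

_≐_ : Rel → Rel → Set
R ≐ S = ∀ M N → R M N ⇔ S M N

_∘ᴿ_ : Rel → Rel → Rel
(S ∘ᴿ R) M N = Σ Term λ K → R M K × S K N

-- The subsidiary evaluator su is idempotent: each of its results is a fixed
-- point of su, and su is deterministic, so su ∘ su = su.  The hybrid hy
-- calls su on every operator before doing anything else, and wherever su
-- itself recurses (bodies, arguments), the provisos let hy use su or hy,
-- both of which already absorb su.  Hence a hy-run from an su-result extends
-- to a hy-run from the original term, and conversely every hy-run factors
-- through the su-result obtained by replaying exactly the su-steps it uses.
-- Under la_e = la_s, ar1_e = ar1_s, ar2_e = ar2_s the evaluator ev is su.
module Submission where

open import Defs
open import Relation.Binary.PropositionalEquality using (_≡_; refl; cong; cong₂)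
open import Data.Product using (Σ; _×_; _,_)
open import Data.Empty using (⊥-elim)
open import Function.Bundles using (mk⇔)

module EvalProperties (la ar1 ar2 : SelfP) where
  open SelfEval la ar1 ar2

  mutual
    Eval-deterministic : ∀ {M K L} → Eval M K → Eval M L → K ≡ L
    Eval-deterministic e-var e-var = refl
    Eval-deterministic (e-lam p) (e-lam q) = cong lam (Par-deterministic p q)
    Eval-deterministic (e-beta d p b) (e-beta d′ p′ b′)
      with Eval-deterministic d d′ | Par-deterministic p p′
    ... | refl | refl = Eval-deterministic b b′
    Eval-deterministic (e-beta d _ _) (e-neu d′ ¬lam _) with Eval-deterministic d d′
    ... | refl = ⊥-elim (¬lam (isLam _))
    Eval-deterministic (e-neu d ¬lam _) (e-beta d′ _ _) with Eval-deterministic d′ d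
    ... | refl = ⊥-elim (¬lam (isLam _))
    Eval-deterministic (e-neu d _ p) (e-neu d′ _ p′) =
      cong₂ app (Eval-deterministic d d′) (Par-deterministic p p′)

    Par-deterministic : ∀ {a M K L} → Par a M K → Par a M L → K ≡ L
    Par-deterministic pid pid = refl
    Par-deterministic (pself d) (pself d′) = Eval-deterministic d d′

  mutual
    Eval-result-fixed : ∀ {M K} → Eval M K → Eval K K
    Eval-result-fixed e-var = e-var
    Eval-result-fixed (e-lam p) = e-lam (Par-result-fixed p)
    Eval-result-fixed (e-beta _ _ b) = Eval-result-fixed b
    Eval-result-fixed (e-neu d ¬lam p) = e-neu (Eval-result-fixed d) ¬lam (Par-result-fixed p)

    Par-result-fixed : ∀ {a M K} → Par a M K → Par a K K
    Par-result-fixed pid = pid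
    Par-result-fixed (pself d) = pself (Eval-result-fixed d)

  Eval-trans : ∀ {M K L} → Eval M K → Eval K L → Eval M L
  Eval-trans d d′ with Eval-deterministic (Eval-result-fixed d) d′
  ... | refl = d

module HybridAbsorbsSubsidiary (ls a1s a2s : SelfP) (lh a2h : HyP)
    (lam-ok : HyPairOK lh ls) (arg-ok : HyPairOK a2h a2s) where
  open SelfEval ls a1s a2s
  open Hybrid ls a1s a2s lh a2h
  open EvalProperties ls a1s a2s

  mutual
    Eval-then-Hy⇒Hy : ∀ {M K W} → Eval M K → Hy K W → Hy M W
    Eval-then-Hy⇒Hy e-var h = h
    Eval-then-Hy⇒Hy (e-lam p) (h-lam q) = h-lam (Par-then-ParH⇒ParH lam-ok p q)
    Eval-then-Hy⇒Hy (e-beta d p b) h = h-beta d p (Eval-then-Hy⇒Hy b h)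
    Eval-then-Hy⇒Hy (e-neu d ¬lam _) (h-beta d′ _ _)
      with Eval-deterministic (Eval-result-fixed d) d′
    ... | refl = ⊥-elim (¬lam (isLam _))
    Eval-then-Hy⇒Hy (e-neu d _ p) (h-neu d′ ¬lam h q) =
      h-neu (Eval-trans d d′) ¬lam h (Par-then-ParH⇒ParH arg-ok p q)

    Par-then-ParH⇒ParH : ∀ {h s N N₁ N₂} →
      HyPairOK h s → Par s N N₁ → ParH h N₁ N₂ → ParH h N N₂
    Par-then-ParH⇒ParH ok-id-id pid q = q
    Par-then-ParH⇒ParH ok-su-id pid q = q
    Par-then-ParH⇒ParH ok-hy-id pid q = q
    Par-then-ParH⇒ParH ok-su-su (pself d) (hsu d′) = hsu (Eval-trans d d′)
    Par-then-ParH⇒ParH ok-hy-su (pself d) (hhy h) = hhy (Eval-then-Hy⇒Hy d h)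

  mutual
    Hy⇒Eval-then-Hy : ∀ {M W} → Hy M W → Σ Term λ K → Eval M K × Hy K W
    Hy⇒Eval-then-Hy h-var = _ , e-var , h-var
    Hy⇒Eval-then-Hy (h-lam q) with ParH⇒Par-then-ParH lam-ok q
    ... | B , p , q′ = lam B , e-lam p , h-lam q′
    Hy⇒Eval-then-Hy (h-beta d p h) with Hy⇒Eval-then-Hy h
    ... | K , e , h′ = K , e-beta d p e , h′
    Hy⇒Eval-then-Hy (h-neu d ¬lam h q) with ParH⇒Par-then-ParH arg-ok q
    ... | N , p , q′ = app _ N , e-neu d ¬lam p , h-neu (Eval-result-fixed d) ¬lam h q′

    ParH⇒Par-then-ParH : ∀ {h s N N₂} →
      HyPairOK h s → ParH h N N₂ → Σ Term λ N₁ → Par s N N₁ × ParH h N₁ N₂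
    ParH⇒Par-then-ParH ok-id-id q = _ , pid , q
    ParH⇒Par-then-ParH ok-su-id q = _ , pid , q
    ParH⇒Par-then-ParH ok-hy-id q = _ , pid , q
    ParH⇒Par-then-ParH ok-su-su (hsu d) = _ , pself d , hsu (Eval-result-fixed d)
    ParH⇒Par-then-ParH ok-hy-su (hhy h) with Hy⇒Eval-then-Hy h
    ... | K , e , h′ = K , pself e , hhy h′

  Hy-absorbs-Su : (Hy ∘ᴿ Su ls a1s a2s) ≐ Hy
  Hy-absorbs-Su M W =
    mk⇔ (λ { (K , e , h) → Eval-then-Hy⇒Hy e h }) Hy⇒Eval-then-Hy

corollary8p4 : (le a1e a2e : SelfP) (lr a2r : RbP) (ls a1s a2s : SelfP) (lh a2h : HyP) →
    RbProviso le a2e lr a2r →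
    HyProviso ls a2s lh a2h →
    le ≡ ls → a1e ≡ a1s → a2e ≡ a2s →
    CompEq lr le lh → CompEq a2r a2e a2h →
    (HyE ls a1s a2s lh a2h ∘ᴿ Ev le a1e a2e) ≐ HyE ls a1s a2s lh a2h
corollary8p4 _ _ _ _ _ ls a1s a2s lh a2h _ (lam-ok , arg-ok , _) refl refl refl _ _ =
  HybridAbsorbsSubsidiary.Hy-absorbs-Su ls a1s a2s lh a2h lam-ok arg-ok
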